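{- Let $G$ be a finite almost simple group, $S=\mathrm{soc}(G)$, and $N=N_{\mathrm{Sym}(G)}(S^*)$. Then $N=D(2,G)$.
   Context: $G$ is almost simple if $\mathrm{soc}(G)$ is a nonabelian simple group. For $L\le G$, $L_{left}$ and $L_{right}$ are the subgroups of $\mathrm{Sym}(G)$ formed by the permutations $g\mapsto xg$ and $g\mapsto gx$ ($x\in L$), and $L^*=L_{left}L_{right}$. $\mathrm{Hol}(G)=N_{\mathrm{Sym}(G)}(G_{right})$, and $D(2,G)$ is the subgroup of $\mathrm{Sym}(G)$ generated by $\mathrm{Hol}(G)$ and $\sigma:g\mapsto g^{ -1}$. -}

module Defs where

open import Level using (0ℓ)
open import Data.Nat using (ℕ)
open import Data.Fin using (Fin)
open import Data.Fin.Subset using (Subset; _∈_; _⊆_)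
open import Data.Fin.Permutation using (Permutation′; _⟨$⟩ʳ_; _∘ₚ_; flip; id; _≈_)
open import Data.Product using (Σ; ∃; _×_; _,_)
open import Data.Sum using (_⊎_)
open import Relation.Nullary using (¬_)
open import Relation.Binary.PropositionalEquality using (_≡_)
open import Algebra.Structures using (IsGroup)

-- A finite group, presented (up to isomorphism) on the carrier Fin n.
record FinGroup : Set where
  field
    n       : ℕ
    _·_     : Fin n → Fin n → Fin n
    e       : Fin n
    _⁻¹     : Fin n → Fin n
    isGroup : IsGroup _≡_ _·_ e _⁻¹
  infixl 7 _·_

module _ (G : FinGroup) where
  open FinGroup G

  IsSubgroup : Subset n → Set
  IsSubgroup H = (e ∈ H) × (∀ {x y} → x ∈ H → y ∈ H → (x · y) ∈ H)
                         × (∀ {x} → x ∈ H → (x ⁻¹) ∈ H)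

  IsNormal : Subset n → Set
  IsNormal H = IsSubgroup H × (∀ g {h} → h ∈ H → (g · h · g ⁻¹) ∈ H)

  Trivial : Subset n → Set
  Trivial H = ∀ {x} → x ∈ H → x ≡ e

  IsMinimalNormal : Subset n → Set
  IsMinimalNormal M = IsNormal M × ¬ Trivial M
    × (∀ K → IsNormal K → K ⊆ M → Trivial K ⊎ K ≡ M)

  -- S = soc(G): the subgroup generated by all minimal normal subgroups,
  -- i.e. the smallest subgroup containing every minimal normal subgroup.
  IsSocle : Subset n → Set₀
  IsSocle S = IsSubgroup S
    × (∀ M → IsMinimalNormal M → M ⊆ S)
    × (∀ H → IsSubgroup H → (∀ M → IsMinimalNormal M → M ⊆ H) → S ⊆ H)

  IsNonabelianSimple : Subset n → Set
  IsNonabelianSimple S = IsSubgroup S × ¬ Trivial S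
    × (∀ K → IsSubgroup K → K ⊆ S → (∀ s {k} → s ∈ S → k ∈ K → (s · k · s ⁻¹) ∈ K)
         → Trivial K ⊎ K ≡ S)
    × (Σ (Fin n) λ x → Σ (Fin n) λ y → x ∈ S × y ∈ S × ¬ (x · y ≡ y · x))

  IsAlmostSimpleWithSocle : Subset n → Set
  IsAlmostSimpleWithSocle S = IsSocle S × IsNonabelianSimple S

  -- Sym(G) = Permutation′ n; sets of permutations are predicates.
  PermSet : Set₁
  PermSet = Permutation′ n → Set

  Normalizer : PermSet → PermSet
  Normalizer X π = (∀ p → X p → X (flip π ∘ₚ p ∘ₚ π))
                 × (∀ p → X p → X (π ∘ₚ p ∘ₚ flip π))

  -- L* = L_left L_right : permutations g ↦ x g y with x, y ∈ L
  Star : Subset n → PermSet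
  Star L p = Σ (Fin n) λ x → Σ (Fin n) λ y → x ∈ L × y ∈ L × (∀ g → p ⟨$⟩ʳ g ≡ x · g · y)

  Right : PermSet
  Right p = Σ (Fin n) λ x → ∀ g → p ⟨$⟩ʳ g ≡ g · x

  Hol : PermSet
  Hol = Normalizer Right

  -- D(2,G) = ⟨ Hol(G), σ ⟩ ≤ Sym(G), σ : g ↦ g⁻¹
  data D2 : Permutation′ n → Set where
    hol  : ∀ {p} → Hol p → D2 p
    sig  : ∀ {p} → (∀ g → p ⟨$⟩ʳ g ≡ g ⁻¹) → D2 p
    one  : D2 id
    comp : ∀ {p q} → D2 p → D2 q → D2 (p ∘ₚ q)
    inv  : ∀ {p} → D2 p → D2 (flip p)
    ext  : ∀ {p q} → p ≈ q → D2 p → D2 q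

-- A permutation π normalises S* exactly when both π and π⁻¹ conjugate every
-- two-sided translation g ↦ x g y (x, y ∈ S) into another one.
--  * D(2,G) ⊆ N: this property holds for σ : g ↦ g⁻¹ and is closed under
--    composition; an element of Hol(G) is an affine map g ↦ c ψ(g) with
--    ψ ∈ Aut(G), and it has the property because S is characteristic.
--  * N ⊆ D(2,G): for π ∈ N, the elements s ∈ S whose left translation is
--    conjugated by π into a left translation form a normal subgroup of the
--    simple group S.  Either it is S (π preserves sides) or it is trivial, and
--    then, as Z(S) = 1, π turns left translations into right translations
--    (π swaps sides) and π σ preserves sides.  If π preserves sides, so does
--    π⁻¹, and then π is affine (using Z(S) = C_G(S) = 1), i.e. π ∈ Hol(G).
module Submission where

open import Defs
open import Data.Fin.Subset using (Subset)
open import Data.Fin.Permutation using (Permutation′)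
open import Function.Bundles using (_⇔_)

open import Level using (0ℓ)
open import Function.Bundles using (mk⇔)
open import Data.Nat using (ℕ)
open import Data.Bool using (true)
open import Data.Fin using (Fin)
open import Data.Fin.Properties using (_≟_; all?; any?)
open import Data.Fin.Subset using (_∈_; _⊆_; _⊂_; ⊤)
open import Data.Fin.Subset.Properties using (_∈?_; _⊂?_; anySubset?; ⊆-antisym; ∈⊤)
open import Data.Fin.Subset.Induction using (⊂-wellFounded; Acc; acc)
open import Data.Vec using (tabulate)
open import Data.Vec.Properties using (lookup∘tabulate; []=⇒lookup; lookup⇒[]=)
open import Data.Product using (Σ; _×_; _,_; proj₁; proj₂)
open import Data.Sum using (_⊎_; inj₁; inj₂)
open import Data.Empty using (⊥; ⊥-elim)
open import Relation.Nullary using (¬_; Dec; yes; no; does)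
open import Relation.Nullary.Decidable using (_×-dec_; _→-dec_; map′; ¬?)
open import Relation.Binary.PropositionalEquality
open import Algebra.Bundles using (Group)
open import Algebra.Structures using (IsGroup)
import Algebra.Properties.Group as GroupProperties
import Data.Fin.Permutation as Perm
open Perm using (_⟨$⟩ʳ_; _⟨$⟩ˡ_; _∘ₚ_; flip; permutation)

flip-cong : ∀ {n} {π ρ : Permutation′ n} → π Perm.≈ ρ → flip π Perm.≈ flip ρ
flip-cong {π = π} {ρ} π≈ρ g =
  trans (cong (π ⟨$⟩ˡ_) (trans (sym (Perm.inverseʳ ρ)) (sym (π≈ρ _)))) (Perm.inverseˡ π)

module Comprehension {n : ℕ} {Q : Fin n → Set} (Q? : ∀ x → Dec (Q x)) where
  subset : Subset n
  subset = tabulate (λ x → does (Q? x))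

  ∈-intro : ∀ {x} → Q x → x ∈ subset
  ∈-intro {x} qx = lookup⇒[]= x subset (trans (lookup∘tabulate _ x) (accepted (Q? x)))
    where
    accepted : (d : Dec (Q x)) → does d ≡ true
    accepted (yes _) = refl
    accepted (no ¬q) = ⊥-elim (¬q qx)

  ∈-elim : ∀ {x} → x ∈ subset → Q x
  ∈-elim {x} m = witness (Q? x) (trans (sym (lookup∘tabulate _ x)) ([]=⇒lookup m))
    where
    witness : (d : Dec (Q x)) → does d ≡ true → Q x
    witness (yes q) _ = q
    witness (no _) ()

module GroupAlgebra (G : FinGroup) where
  open FinGroup G public
  open IsGroup isGroup public using (assoc; identityˡ; identityʳ; inverseˡ; inverseʳ)
  open ≡-Reasoning

  group : Group 0ℓ 0ℓ
  group = record
    { Carrier = Fin n ; _≈_ = _≡_ ; _∙_ = _·_ ; ε = e ; _⁻¹ = _⁻¹ ; isGroup = isGroup }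

  open GroupProperties group public
    using (∙-cancelˡ; ∙-cancelʳ; ⁻¹-involutive; ⁻¹-anti-homo-∙; inverseʳ-unique)
  open GroupProperties group
    using (\\-leftDividesˡ; \\-leftDividesʳ; //-rightDividesˡ; //-rightDividesʳ)

  inv-cancelˡ : ∀ a x → a ⁻¹ · (a · x) ≡ x
  inv-cancelˡ = \\-leftDividesʳ

  cancelˡ-inv : ∀ a x → a · (a ⁻¹ · x) ≡ x
  cancelˡ-inv = \\-leftDividesˡ

  inv-cancelʳ : ∀ x a → x · a · a ⁻¹ ≡ x
  inv-cancelʳ x a = //-rightDividesʳ a x

  cancelʳ-inv : ∀ x a → x · a ⁻¹ · a ≡ x
  cancelʳ-inv x a = //-rightDividesˡ a x

  solveˡ : ∀ {x y z} → x · y ≡ z → y ≡ x ⁻¹ · z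
  solveˡ {x} {y} eq = trans (sym (inv-cancelˡ x y)) (cong (x ⁻¹ ·_) eq)

  solveʳ : ∀ {x y z} → x · y ≡ z → x ≡ z · y ⁻¹
  solveʳ {x} {y} eq = trans (sym (inv-cancelʳ x y)) (cong (_· y ⁻¹) eq)

  translate-untranslate : ∀ x y g → x · (x ⁻¹ · g · y ⁻¹) · y ≡ g
  translate-untranslate x y g =
    trans (cong (_· y) (trans (sym (assoc _ _ _)) (cong (_· y ⁻¹) (cancelˡ-inv x g))))
          (cancelʳ-inv g y)

  untranslate-translate : ∀ x y g → x ⁻¹ · (x · g · y) · y ⁻¹ ≡ g
  untranslate-translate x y g =
    trans (cong (_· y ⁻¹) (trans (sym (assoc _ _ _)) (cong (_· y) (inv-cancelˡ x g))))
          (inv-cancelʳ g y)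

  untranslate : ∀ {x w y g} → x · w · y ≡ g → w ≡ x ⁻¹ · g · y ⁻¹
  untranslate {x} {w} {y} eq =
    trans (sym (untranslate-translate x y w)) (cong (λ k → x ⁻¹ · k · y ⁻¹) eq)

  translation : Fin n → Fin n → Permutation′ n
  translation x y = permutation (λ g → x · g · y) (λ g → x ⁻¹ · g · y ⁻¹)
                                (translate-untranslate x y) (untranslate-translate x y)

  inversion : Permutation′ n
  inversion = permutation _⁻¹ _⁻¹ ⁻¹-involutive ⁻¹-involutive

  conj-conj : ∀ g h s → g · (h · s · h ⁻¹) · g ⁻¹ ≡ g · h · s · (g · h) ⁻¹
  conj-conj g h s = begin
    g · (h · s · h ⁻¹) · g ⁻¹ ≡⟨ cong (_· g ⁻¹) (sym (assoc _ _ _)) ⟩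
    g · (h · s) · h ⁻¹ · g ⁻¹ ≡⟨ assoc _ _ _ ⟩
    g · (h · s) · (h ⁻¹ · g ⁻¹) ≡⟨ cong₂ _·_ (sym (assoc _ _ _)) (sym (⁻¹-anti-homo-∙ g h)) ⟩
    g · h · s · (g · h) ⁻¹ ∎

  same-conjugate : ∀ {z w t v} → z · t ≡ v · z → w · t ≡ v · w → z ⁻¹ · w · t ≡ t · (z ⁻¹ · w)
  same-conjugate {z} {w} {t} {v} zt wt = begin
    z ⁻¹ · w · t ≡⟨ assoc _ _ _ ⟩
    z ⁻¹ · (w · t) ≡⟨ cong (z ⁻¹ ·_) wt ⟩
    z ⁻¹ · (v · w) ≡⟨ cong (λ k → z ⁻¹ · (v · k)) (sym (cancelˡ-inv z w)) ⟩
    z ⁻¹ · (v · (z · (z ⁻¹ · w))) ≡⟨ cong (z ⁻¹ ·_) (sym (assoc _ _ _)) ⟩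
    z ⁻¹ · (v · z · (z ⁻¹ · w)) ≡⟨ sym (assoc _ _ _) ⟩
    z ⁻¹ · (v · z) · (z ⁻¹ · w) ≡⟨ cong (_· (z ⁻¹ · w)) (sym (solveˡ zt)) ⟩
    t · (z ⁻¹ · w) ∎

  Centralises : Subset n → Fin n → Set
  Centralises X z = ∀ {t} → t ∈ X → z · t ≡ t · z

  centralises? : ∀ X z → Dec (Centralises X z)
  centralises? X z = map′ (λ h {t} m → h t m) (λ h t m → h m)
    (all? λ t → (t ∈? X) →-dec (z · t ≟ t · z))

  centralises-e : ∀ {X} → Centralises X e
  centralises-e {t = t} _ = trans (identityˡ t) (sym (identityʳ t))

  centralises-· : ∀ {X z w} → Centralises X z → Centralises X w → Centralises X (z · w)
  centralises-· {z = z} {w} cz cw {t} tX = begin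
    z · w · t ≡⟨ assoc _ _ _ ⟩
    z · (w · t) ≡⟨ cong (z ·_) (cw tX) ⟩
    z · (t · w) ≡⟨ sym (assoc _ _ _) ⟩
    z · t · w ≡⟨ cong (_· w) (cz tX) ⟩
    t · z · w ≡⟨ assoc _ _ _ ⟩
    t · (z · w) ∎

  centralises-⁻¹ : ∀ {X z} → Centralises X z → Centralises X (z ⁻¹)
  centralises-⁻¹ {z = z} cz {t} tX = begin
    z ⁻¹ · t ≡⟨ sym (inv-cancelʳ _ z) ⟩
    z ⁻¹ · t · z · z ⁻¹ ≡⟨ cong (_· z ⁻¹) (assoc _ _ _) ⟩
    z ⁻¹ · (t · z) · z ⁻¹ ≡⟨ cong (λ w → z ⁻¹ · w · z ⁻¹) (sym (cz tX)) ⟩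
    z ⁻¹ · (z · t) · z ⁻¹ ≡⟨ cong (_· z ⁻¹) (inv-cancelˡ z t) ⟩
    t · z ⁻¹ ∎

  module Endomorphism (ψ : Fin n → Fin n) (ψ-hom : ∀ x y → ψ (x · y) ≡ ψ x · ψ y) where
    ψ-e : ψ e ≡ e
    ψ-e = ∙-cancelˡ (ψ e) _ _
      (trans (sym (ψ-hom e e)) (trans (cong ψ (identityˡ e)) (sym (identityʳ _))))

    ψ-⁻¹ : ∀ x → ψ (x ⁻¹) ≡ ψ x ⁻¹
    ψ-⁻¹ x = inverseʳ-unique (ψ x) (ψ (x ⁻¹))
      (trans (sym (ψ-hom x (x ⁻¹))) (trans (cong ψ (inverseʳ x)) ψ-e))

  module Apply (π : Permutation′ n) where
    f f⁻ : Fin n → Fin n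
    f = π ⟨$⟩ʳ_
    f⁻ = π ⟨$⟩ˡ_

    f⁻-f : ∀ h → f⁻ (f h) ≡ h
    f⁻-f h = Perm.inverseˡ π

    f-f⁻ : ∀ g → f (f⁻ g) ≡ g
    f-f⁻ g = Perm.inverseʳ π

    linear : Fin n → Fin n
    linear x = f e ⁻¹ · f x

module Subgroups (G : FinGroup) where
  open GroupAlgebra G
  open ≡-Reasoning

  trivial? : ∀ K → Dec (Trivial G K)
  trivial? K = map′ (λ h {x} m → h x m) (λ h x m → h m)
    (all? (λ x → (x ∈? K) →-dec (x ≟ e)))

  subgroup? : ∀ H → Dec (IsSubgroup G H)
  subgroup? H = (e ∈? H)
    ×-dec map′ (λ h {x} {y} a b → h x y a b) (λ h x y a b → h a b)
            (all? λ x → all? λ y → (x ∈? H) →-dec ((y ∈? H) →-dec ((x · y) ∈? H)))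
    ×-dec map′ (λ h {x} a → h x a) (λ h x a → h a)
            (all? λ x → (x ∈? H) →-dec ((x ⁻¹) ∈? H))

  normal? : ∀ H → Dec (IsNormal G H)
  normal? H = subgroup? H
    ×-dec map′ (λ h g {k} m → h g k m) (λ h g k m → h g m)
            (all? λ g → all? λ k → (k ∈? H) →-dec ((g · k · g ⁻¹) ∈? H))

  minimalNormalBelow : ∀ K → IsNormal G K → ¬ Trivial G K
                     → Σ (Subset n) λ M → IsMinimalNormal G M × M ⊆ K
  minimalNormalBelow K = descend K (⊂-wellFounded K)
    where
    descend : ∀ K → Acc _⊂_ K → IsNormal G K → ¬ Trivial G K
            → Σ (Subset n) λ M → IsMinimalNormal G M × M ⊆ K
    descend K (acc smaller) nK ntK
      with anySubset? (λ K′ → normal? K′ ×-dec (¬? (trivial? K′) ×-dec (K′ ⊂? K)))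
    ... | yes (K′ , nK′ , ntK′ , K′⊂K) =
      let (M , minM , M⊆K′) = descend K′ (smaller K′⊂K) nK′ ntK′
      in M , minM , λ x → proj₁ K′⊂K (M⊆K′ x)
    ... | no noSmaller = K , (nK , ntK , minimal) , λ x → x
      where
      minimal : ∀ K′ → IsNormal G K′ → K′ ⊆ K → Trivial G K′ ⊎ K′ ≡ K
      minimal K′ nK′ K′⊆K with trivial? K′
      ... | yes t = inj₁ t
      ... | no nt = inj₂ (⊆-antisym K′⊆K K⊆K′)
        where
        K⊆K′ : K ⊆ K′
        K⊆K′ {x} xK with x ∈? K′
        ... | yes m = m
        ... | no nm = ⊥-elim (noSmaller (K′ , nK′ , nt , K′⊆K , x , xK , nm))

  ⊤-normal : IsNormal G ⊤
  ⊤-normal = (∈⊤ , (λ _ _ → ∈⊤) , (λ _ → ∈⊤)) , (λ _ _ → ∈⊤)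

  module Centraliser (X : Subset n) where
    open Comprehension (centralises? X) public renaming (subset to C)

    isSubgroup : IsSubgroup G C
    isSubgroup = ∈-intro centralises-e
               , (λ a b → ∈-intro (centralises-· (∈-elim a) (∈-elim b)))
               , (λ a → ∈-intro (centralises-⁻¹ (∈-elim a)))

    isNormal : IsNormal G X → IsNormal G C
    isNormal (_ , conjX) = isSubgroup , λ g {k} km → ∈-intro λ {t} tX →
      let t′ = g ⁻¹ · t · g
          t′X : t′ ∈ X
          t′X = subst (λ w → (g ⁻¹ · t · w) ∈ X) (⁻¹-involutive g) (conjX (g ⁻¹) tX)
          gt′ : g · t′ ≡ t · g
          gt′ = trans (sym (assoc _ _ _)) (cong (_· g) (cancelˡ-inv g t))
      in begin
        g · k · g ⁻¹ · t ≡⟨ assoc _ _ _ ⟩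
        g · k · (g ⁻¹ · t) ≡⟨ cong (g · k ·_) (sym (inv-cancelʳ (g ⁻¹ · t) g)) ⟩
        g · k · (t′ · g ⁻¹) ≡⟨ sym (assoc _ _ _) ⟩
        g · k · t′ · g ⁻¹ ≡⟨ cong (_· g ⁻¹) (assoc _ _ _) ⟩
        g · (k · t′) · g ⁻¹ ≡⟨ cong (λ w → g · w · g ⁻¹) (∈-elim km t′X) ⟩
        g · (t′ · k) · g ⁻¹ ≡⟨ cong (_· g ⁻¹) (sym (assoc _ _ _)) ⟩
        g · t′ · k · g ⁻¹ ≡⟨ cong (λ w → w · k · g ⁻¹) gt′ ⟩
        t · g · k · g ⁻¹ ≡⟨ cong (_· g ⁻¹) (assoc _ _ _) ⟩
        t · (g · k) · g ⁻¹ ≡⟨ assoc _ _ _ ⟩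
        t · (g · k · g ⁻¹) ∎

  module Centre (X : Subset n) where
    open Comprehension (λ z → (z ∈? X) ×-dec centralises? X z) public renaming (subset to Z)

    isSubgroup : IsSubgroup G X → IsSubgroup G Z
    isSubgroup (eX , ·X , ⁻¹X) =
        ∈-intro (eX , centralises-e)
      , (λ a b → let (aX , ca) = ∈-elim a ; (bX , cb) = ∈-elim b in
                 ∈-intro (·X aX bX , centralises-· ca cb))
      , (λ a → let (aX , ca) = ∈-elim a in ∈-intro (⁻¹X aX , centralises-⁻¹ ca))

    normalised : ∀ s {k} → s ∈ X → k ∈ Z → (s · k · s ⁻¹) ∈ Z
    normalised s {k} sX km = subst (_∈ Z) k≡sks⁻¹ km
      where
      k≡sks⁻¹ : k ≡ s · k · s ⁻¹
      k≡sks⁻¹ = sym (trans (cong (_· s ⁻¹) (sym (proj₂ (∈-elim km) sX))) (inv-cancelʳ k s))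

  module Preimage (ψ : Fin n → Fin n) (ψ-hom : ∀ x y → ψ (x · y) ≡ ψ x · ψ y) (X : Subset n) where
    open Comprehension (λ y → ψ y ∈? X) public renaming (subset to P)
    open Endomorphism ψ ψ-hom

    isNormal : IsNormal G X → IsNormal G P
    isNormal ((eX , ·X , ⁻¹X) , conjX) =
        ( ∈-intro (subst (_∈ X) (sym ψ-e) eX)
        , (λ {x} {y} a b → ∈-intro (subst (_∈ X) (sym (ψ-hom x y)) (·X (∈-elim a) (∈-elim b))))
        , (λ {x} a → ∈-intro (subst (_∈ X) (sym (ψ-⁻¹ x)) (⁻¹X (∈-elim a)))))
      , λ g {k} km → ∈-intro (subst (_∈ X) (sym (ψ-conj g k)) (conjX (ψ g) (∈-elim km)))
      where
      ψ-conj : ∀ g k → ψ (g · k · g ⁻¹) ≡ ψ g · ψ k · ψ g ⁻¹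
      ψ-conj g k = trans (ψ-hom _ _) (cong₂ _·_ (ψ-hom g k) (ψ-⁻¹ g))

-- Hol(G) = N_Sym(G)(G_right) consists of the affine permutations
-- π(h x) = π(h) ψ(x), where ψ = π(1)⁻¹ π is then an automorphism.
module Holomorph (G : FinGroup) where
  open GroupAlgebra G
  open ≡-Reasoning

  Affine : Permutation′ n → Set
  Affine π = ∀ h x → f (h · x) ≡ f h · linear x
    where open Apply π

  module AffineMap (π : Permutation′ n) (aff : Affine π) where
    open Apply π

    c : Fin n
    c = f e

    linear-hom : ∀ x y → linear (x · y) ≡ linear x · linear y
    linear-hom x y = trans (cong (c ⁻¹ ·_) (aff x y)) (sym (assoc _ _ _))

    section : Fin n → Fin n
    section y = f⁻ (c · y)

    linear-section : ∀ y → linear (section y) ≡ y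
    linear-section y = trans (cong (c ⁻¹ ·_) (f-f⁻ _)) (inv-cancelˡ c y)

    translate-section : ∀ g y → f (g · section y) ≡ f g · y
    translate-section g y = trans (aff g _) (cong (f g ·_) (linear-section y))

    two-sided : ∀ x h y → f (x · h · y) ≡ c · linear x · c ⁻¹ · f h · linear y
    two-sided x h y = begin
      f (x · h · y) ≡⟨ aff _ y ⟩
      f (x · h) · linear y ≡⟨ cong (_· linear y) (aff x h) ⟩
      f x · (c ⁻¹ · f h) · linear y ≡⟨ cong (_· linear y) (sym (assoc _ _ _)) ⟩
      f x · c ⁻¹ · f h · linear y ≡⟨ cong (λ w → w · c ⁻¹ · f h · linear y) (sym (cancelˡ-inv c (f x))) ⟩
      c · linear x · c ⁻¹ · f h · linear y ∎

  affine⇒hol : ∀ {π} → Affine π → Hol G π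
  affine⇒hol {π} aff =
      (λ p (x , px) → linear x , λ g → begin
        f (p ⟨$⟩ʳ f⁻ g) ≡⟨ cong f (px (f⁻ g)) ⟩
        f (f⁻ g · x) ≡⟨ aff (f⁻ g) x ⟩
        f (f⁻ g) · linear x ≡⟨ cong (_· linear x) (f-f⁻ g) ⟩
        g · linear x ∎)
    , (λ p (x , px) → section x , λ g → begin
        f⁻ (p ⟨$⟩ʳ f g) ≡⟨ cong f⁻ (px (f g)) ⟩
        f⁻ (f g · x) ≡⟨ cong f⁻ (sym (translate-section g x)) ⟩
        f⁻ (f (g · section x)) ≡⟨ f⁻-f _ ⟩
        g · section x ∎)
    where
    open Apply π
    open AffineMap π aff

  -- conjugating the right translation by x into some right translation by y
  -- forces π(h x) = π(h) y for all h, and y = ψ(x)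
  hol⇒affine : ∀ {π} → Hol G π → Affine π
  hol⇒affine {π} (conjRight , _) h x = trans (f-right h) (cong (f h ·_) y≡ψx)
    where
    open Apply π
    conjugate = conjRight (translation e x) (x , λ g → cong (_· x) (identityˡ g))
    y = proj₁ conjugate
    f-right : ∀ h → f (h · x) ≡ f h · y
    f-right h = trans (cong (λ w → f (w · x)) (trans (sym (identityˡ h)) (cong (e ·_) (sym (f⁻-f h)))))
                      (proj₂ conjugate (f h))
    y≡ψx : y ≡ linear x
    y≡ψx = solveˡ (trans (sym (f-right e)) (cong f (identityˡ x)))

  hol-flip : ∀ {π} → Hol G π → Hol G (flip π)
  hol-flip (into , back) = back , into

-- π maps X* into itself: for every two-sided translation ρ : g ↦ x g y with
-- x, y ∈ X, the conjugate π ρ π⁻¹ is again such a translation.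
module TwoSidedTranslations (G : FinGroup) (X : Subset (FinGroup.n G)) where
  open GroupAlgebra G
  open Holomorph G
  open ≡-Reasoning

  MapsStar : Permutation′ n → Set
  MapsStar π = ∀ {x y} → x ∈ X → y ∈ X → Σ (Fin n) λ a → Σ (Fin n) λ b →
                 a ∈ X × b ∈ X × (∀ g → f (x · f⁻ g · y) ≡ a · g · b)
    where open Apply π

  normaliser⇒maps : ∀ {π} → Normalizer G (Star G X) π → MapsStar π × MapsStar (flip π)
  normaliser⇒maps (into , back) =
      (λ {x} {y} xX yX → into (translation x y) (x , y , xX , yX , λ _ → refl))
    , (λ {x} {y} xX yX → back (translation x y) (x , y , xX , yX , λ _ → refl))

  maps⇒normaliser : ∀ {π} → MapsStar π → MapsStar (flip π) → Normalizer G (Star G X) π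
  maps⇒normaliser {π} mπ mπ⁻ =
      (λ p (x , y , xX , yX , px) → let (a , b , aX , bX , eq) = mπ xX yX in
         a , b , aX , bX , λ g → trans (cong f (px (f⁻ g))) (eq g))
    , (λ p (x , y , xX , yX , px) → let (a , b , aX , bX , eq) = mπ⁻ xX yX in
         a , b , aX , bX , λ g → trans (cong f⁻ (px (f g))) (eq g))
    where open Apply π

  maps-id : MapsStar Perm.id
  maps-id xX yX = _ , _ , xX , yX , λ _ → refl

  maps-∘ : ∀ {π ρ} → MapsStar π → MapsStar ρ → MapsStar (π ∘ₚ ρ)
  maps-∘ {π} {ρ} mπ mρ xX yX =
    let (a , b , aX , bX , eq) = mπ xX yX ; (a′ , b′ , a′X , b′X , eq′) = mρ aX bX in
    a′ , b′ , a′X , b′X , λ g → trans (cong (ρ ⟨$⟩ʳ_) (eq (ρ ⟨$⟩ˡ g))) (eq′ g)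

  maps-≈ : ∀ {π ρ} → π Perm.≈ ρ → MapsStar π → MapsStar ρ
  maps-≈ {π} {ρ} π≈ρ mπ {x} {y} xX yX = let (a , b , aX , bX , eq) = mπ xX yX in
    a , b , aX , bX , λ g → begin
      ρ ⟨$⟩ʳ (x · (ρ ⟨$⟩ˡ g) · y) ≡⟨ sym (π≈ρ _) ⟩
      π ⟨$⟩ʳ (x · (ρ ⟨$⟩ˡ g) · y) ≡⟨ cong (λ w → π ⟨$⟩ʳ (x · w · y)) (sym (flip-cong {π = π} {ρ} π≈ρ g)) ⟩
      π ⟨$⟩ʳ (x · (π ⟨$⟩ˡ g) · y) ≡⟨ eq g ⟩
      a · g · b ∎

  maps-inversion : (∀ {x} → x ∈ X → (x ⁻¹) ∈ X) → MapsStar inversion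
  maps-inversion ⁻¹X {x} {y} xX yX = y ⁻¹ , x ⁻¹ , ⁻¹X yX , ⁻¹X xX , λ g → begin
    (x · g ⁻¹ · y) ⁻¹ ≡⟨ ⁻¹-anti-homo-∙ _ y ⟩
    y ⁻¹ · (x · g ⁻¹) ⁻¹ ≡⟨ cong (y ⁻¹ ·_) (⁻¹-anti-homo-∙ x (g ⁻¹)) ⟩
    y ⁻¹ · (g ⁻¹ ⁻¹ · x ⁻¹) ≡⟨ cong (λ w → y ⁻¹ · (w · x ⁻¹)) (⁻¹-involutive g) ⟩
    y ⁻¹ · (g · x ⁻¹) ≡⟨ sym (assoc _ _ _) ⟩
    y ⁻¹ · g · x ⁻¹ ∎

  maps-affine : ∀ {π} → IsNormal G X → Affine π → (∀ {x} → x ∈ X → Apply.linear π x ∈ X)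
              → MapsStar π
  maps-affine {π} (_ , conjX) aff ψX {x} {y} xX yX =
    c · linear x · c ⁻¹ , linear y , conjX c (ψX xX) , ψX yX , λ g →
      trans (two-sided x (f⁻ g) y) (cong (λ w → c · linear x · c ⁻¹ · w · linear y) (f-f⁻ g))
    where
    open Apply π
    open AffineMap π aff

module AlmostSimple (G : FinGroup) (S : Subset (FinGroup.n G))
                    (AS : IsAlmostSimpleWithSocle G S) where
  open GroupAlgebra G
  open Holomorph G
  open Subgroups G

  private
    socle = proj₁ AS
    simple = proj₂ AS
    nonabelian = proj₂ (proj₂ (proj₂ simple))
    module ZS = Centre S
    module CS = Centraliser S

  S-subgroup : IsSubgroup G S
  S-subgroup = proj₁ simple

  e∈S : e ∈ S
  e∈S = proj₁ S-subgroup

  ·-closed : ∀ {x y} → x ∈ S → y ∈ S → (x · y) ∈ S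
  ·-closed = proj₁ (proj₂ S-subgroup)

  ⁻¹-closed : ∀ {x} → x ∈ S → (x ⁻¹) ∈ S
  ⁻¹-closed = proj₂ (proj₂ S-subgroup)

  S-simple : ∀ K → IsSubgroup G K → K ⊆ S → (∀ s {k} → s ∈ S → k ∈ K → (s · k · s ⁻¹) ∈ K)
           → Trivial G K ⊎ K ≡ S
  S-simple = proj₁ (proj₂ (proj₂ simple))

  x₀ y₀ : Fin n
  x₀ = proj₁ nonabelian
  y₀ = proj₁ (proj₂ nonabelian)

  x₀∈S : x₀ ∈ S
  x₀∈S = proj₁ (proj₂ (proj₂ nonabelian))

  y₀∈S : y₀ ∈ S
  y₀∈S = proj₁ (proj₂ (proj₂ (proj₂ nonabelian)))

  x₀y₀≢y₀x₀ : ¬ (x₀ · y₀ ≡ y₀ · x₀)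
  x₀y₀≢y₀x₀ = proj₂ (proj₂ (proj₂ (proj₂ nonabelian)))

  x₀≢e : ¬ (x₀ ≡ e)
  x₀≢e x₀≡e = x₀y₀≢y₀x₀ (subst (λ w → w · y₀ ≡ y₀ · w) (sym x₀≡e) (centralises-e y₀∈S))

  -- a minimal normal subgroup lies in the socle S and is normalised by S, so
  -- it is S by simplicity
  minimal≡S : ∀ M → IsMinimalNormal G M → M ≡ S
  minimal≡S M minM@((M-subgroup , M-conj) , M-nontrivial , _)
    with S-simple M M-subgroup (proj₁ (proj₂ socle) M minM) (λ s _ km → M-conj s km)
  ... | inj₁ triv = ⊥-elim (M-nontrivial triv)
  ... | inj₂ M≡S = M≡S

  S⊆normal : ∀ K → IsNormal G K → ¬ Trivial G K → S ⊆ K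
  S⊆normal K nK ntK =
    let (M , minM , M⊆K) = minimalNormalBelow K nK ntK in subst (_⊆ K) (minimal≡S M minM) M⊆K

  S-normal : IsNormal G S
  S-normal =
    let (M , minM , _) = minimalNormalBelow ⊤ ⊤-normal (λ triv → x₀≢e (triv ∈⊤))
    in subst (IsNormal G) (minimal≡S M minM) (proj₁ minM)

  conj-closed : ∀ g {s} → s ∈ S → (g · s · g ⁻¹) ∈ S
  conj-closed = proj₂ S-normal

  -- Z(S) = 1: Z(S) is normalised by S and cannot be all of S
  centre-trivial : ∀ {z} → z ∈ S → Centralises S z → z ≡ e
  centre-trivial zS cz
    with S-simple ZS.Z (ZS.isSubgroup S-subgroup) (λ m → proj₁ (ZS.∈-elim m)) ZS.normalised
  ... | inj₁ triv = triv (ZS.∈-intro (zS , cz))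
  ... | inj₂ Z≡S = ⊥-elim (x₀y₀≢y₀x₀ (proj₂ (ZS.∈-elim (subst (x₀ ∈_) (sym Z≡S) x₀∈S)) y₀∈S))

  -- C_G(S) = 1: a nontrivial C_G(S) is normal, so it contains S and x₀ ∈ Z(S)
  centraliser-trivial : ∀ {z} → Centralises S z → z ≡ e
  centraliser-trivial {z} cz with z ≟ e
  ... | yes z≡e = z≡e
  ... | no z≢e = ⊥-elim (x₀≢e (centre-trivial x₀∈S (CS.∈-elim x₀∈C)))
    where
    x₀∈C : x₀ ∈ CS.C
    x₀∈C = S⊆normal CS.C (CS.isNormal S-normal) (λ triv → z≢e (triv (CS.∈-intro cz))) x₀∈S

  -- S is characteristic: ψ(S) ⊆ S for every surjective endomorphism ψ, since
  -- the preimage of S under ψ is a nontrivial normal subgroup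
  characteristic : (ψ θ : Fin n → Fin n) → (∀ x y → ψ (x · y) ≡ ψ x · ψ y) → (∀ y → ψ (θ y) ≡ y)
                 → ∀ {s} → s ∈ S → ψ s ∈ S
  characteristic ψ θ ψ-hom ψ-θ sS = ∈-elim (S⊆normal P (isNormal S-normal) nontrivial sS)
    where
    open Preimage ψ ψ-hom S
    open Endomorphism ψ ψ-hom
    θx₀∈P : θ x₀ ∈ P
    θx₀∈P = ∈-intro (subst (_∈ S) (sym (ψ-θ x₀)) x₀∈S)
    nontrivial : ¬ Trivial G P
    nontrivial triv = x₀≢e (trans (sym (ψ-θ x₀)) (trans (cong ψ (triv θx₀∈P)) ψ-e))

  linear-preserves-S : ∀ {π} → Affine π → ∀ {s} → s ∈ S → Apply.linear π s ∈ S
  linear-preserves-S {π} aff = characteristic linear section linear-hom linear-section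
    where
    open Apply π
    open AffineMap π aff

-- For π ∈ N and s ∈ S, the conjugate π s_left π⁻¹ of the
-- left translation by s is a two-sided translation; either all of them are
-- left translations (π preserves sides) or all are right translations.
module Sides (G : FinGroup) (S : Subset (FinGroup.n G)) (AS : IsAlmostSimpleWithSocle G S) where
  open GroupAlgebra G
  open Holomorph G
  open TwoSidedTranslations G S
  open AlmostSimple G S AS
  open ≡-Reasoning

  conjLeft : Permutation′ n → Fin n → Fin n → Fin n
  conjLeft π s g = f (s · f⁻ g)
    where open Apply π

  PreservesSides SwapsSides : Permutation′ n → Set
  PreservesSides π = ∀ {s} → s ∈ S → Σ (Fin n) λ a → a ∈ S × (∀ g → conjLeft π s g ≡ a · g)
  SwapsSides π = ∀ {s} → s ∈ S → Σ (Fin n) λ b → b ∈ S × (∀ g → conjLeft π s g ≡ g · b)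

  module LeftConjugation (π : Permutation′ n) where
    open Apply π

    F : Fin n → Fin n → Fin n
    F = conjLeft π

    F-· : ∀ s t g → F (s · t) g ≡ F s (F t g)
    F-· s t g = cong f (trans (assoc _ _ _) (cong (s ·_) (sym (f⁻-f _))))

    F-e : ∀ g → F e g ≡ g
    F-e g = trans (cong f (identityˡ _)) (f-f⁻ g)

    F-⁻¹ : ∀ s g → F s (F (s ⁻¹) g) ≡ g
    F-⁻¹ s g = trans (sym (F-· s (s ⁻¹) g)) (trans (cong (λ w → F w g) (inverseʳ s)) (F-e g))

  module Dichotomy (π : Permutation′ n) (mπ : MapsStar π) (mπ⁻ : MapsStar (flip π)) where
    open Apply π
    open LeftConjugation π

    F-two-sided : ∀ {s} → s ∈ S → Σ (Fin n) λ a → Σ (Fin n) λ b →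
                    a ∈ S × b ∈ S × (∀ g → F s g ≡ a · g · b)
    F-two-sided sS = let (a , b , aS , bS , eq) = mπ sS e∈S in
      a , b , aS , bS , λ g → trans (cong f (sym (identityʳ _))) (eq g)

    F-inverse : ∀ {s a b} → (∀ g → F s g ≡ a · g · b) → ∀ g → F (s ⁻¹) g ≡ a ⁻¹ · g · b ⁻¹
    F-inverse {s} eq g = untranslate (trans (sym (eq _)) (F-⁻¹ s g))

    -- conjugating F s by the left translation by u ∈ S gives F at a conjugate
    -- p s p⁻¹, where π⁻¹ u_left π is the translation g ↦ p g q
    F-conjugate : ∀ {u} → u ∈ S → Σ (Fin n) λ p → p ∈ S ×
                    (∀ s g → u · F s (u ⁻¹ · g) ≡ F (p · s · p ⁻¹) g)
    F-conjugate {u} uS with mπ⁻ uS e∈S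
    ... | (p , q , pS , _ , eq) = p , pS , λ s g → begin
        u · f (s · h₀ g) ≡⟨ u-f (s · h₀ g) ⟩
        f (p · (s · h₀ g) · q) ≡⟨ cong f (regroup s (h₀ g)) ⟩
        f (p · s · p ⁻¹ · (p · h₀ g · q)) ≡⟨ cong (λ w → f (p · s · p ⁻¹ · w)) (ph₀q g) ⟩
        f (p · s · p ⁻¹ · f⁻ g) ∎
      where
      f⁻-u : ∀ k → f⁻ (u · f k) ≡ p · k · q
      f⁻-u k = trans (cong f⁻ (sym (identityʳ _))) (eq k)
      u-f : ∀ k → u · f k ≡ f (p · k · q)
      u-f k = trans (sym (f-f⁻ _)) (cong f (f⁻-u k))
      h₀ : Fin n → Fin n
      h₀ g = f⁻ (u ⁻¹ · g)
      ph₀q : ∀ g → p · h₀ g · q ≡ f⁻ g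
      ph₀q g = trans (sym (f⁻-u (h₀ g))) (cong f⁻ (trans (cong (u ·_) (f-f⁻ _)) (cancelˡ-inv u g)))
      regroup : ∀ s h → p · (s · h) · q ≡ p · s · p ⁻¹ · (p · h · q)
      regroup s h = begin
        p · (s · h) · q ≡⟨ assoc _ _ _ ⟩
        p · (s · h · q) ≡⟨ cong (p ·_) (assoc _ _ _) ⟩
        p · (s · (h · q)) ≡⟨ sym (assoc _ _ _) ⟩
        p · s · (h · q) ≡⟨ cong (λ w → p · s · (w · q)) (sym (inv-cancelˡ p h)) ⟩
        p · s · (p ⁻¹ · (p · h) · q) ≡⟨ cong (p · s ·_) (assoc _ _ _) ⟩
        p · s · (p ⁻¹ · (p · h · q)) ≡⟨ sym (assoc _ _ _) ⟩
        p · s · p ⁻¹ · (p · h · q) ∎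

    LeftLike : Fin n → Set
    LeftLike s = s ∈ S × Σ (Fin n) λ a → a ∈ S × (∀ g → F s g ≡ a · g)

    private
      module K = Comprehension {Q = LeftLike}
        (λ s → (s ∈? S) ×-dec any? (λ a → (a ∈? S) ×-dec all? (λ g → F s g ≟ a · g)))

    leftLike-subgroup : IsSubgroup G K.subset
    leftLike-subgroup =
        K.∈-intro (e∈S , e , e∈S , λ g → trans (F-e g) (sym (identityˡ g)))
      , (λ {s} {t} sK tK → let (sS , a , aS , Fs) = K.∈-elim sK ; (tS , a′ , a′S , Ft) = K.∈-elim tK in
           K.∈-intro (·-closed sS tS , a · a′ , ·-closed aS a′S , λ g →
             trans (F-· s t g) (trans (cong (F s) (Ft g)) (trans (Fs _) (sym (assoc _ _ _))))))
      , (λ {s} sK → let (sS , a , aS , Fs) = K.∈-elim sK in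
           K.∈-intro (⁻¹-closed sS , a ⁻¹ , ⁻¹-closed aS , λ g →
             solveˡ (trans (sym (Fs _)) (F-⁻¹ s g))))

    leftLike-normalised : ∀ u {k} → u ∈ S → k ∈ K.subset → (u · k · u ⁻¹) ∈ K.subset
    leftLike-normalised u {k} uS kK with K.∈-elim kK | F-two-sided uS
    ... | (kS , a , aS , Fk) | (x , y , _ , _ , Fu) =
      K.∈-intro (conj-closed u kS , x · a · x ⁻¹ , conj-closed x aS , λ g → begin
        F (u · k · u ⁻¹) g ≡⟨ F-· (u · k) (u ⁻¹) g ⟩
        F (u · k) (F (u ⁻¹) g) ≡⟨ F-· u k _ ⟩
        F u (F k (F (u ⁻¹) g)) ≡⟨ cong (λ w → F u (F k w)) (F-inverse Fu g) ⟩
        F u (F k (x ⁻¹ · g · y ⁻¹)) ≡⟨ cong (F u) (Fk _) ⟩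
        F u (a · (x ⁻¹ · g · y ⁻¹)) ≡⟨ Fu _ ⟩
        x · (a · (x ⁻¹ · g · y ⁻¹)) · y ≡⟨ cong (_· y) (sym (assoc _ _ _)) ⟩
        x · a · (x ⁻¹ · g · y ⁻¹) · y ≡⟨ assoc _ _ _ ⟩
        x · a · (x ⁻¹ · g · y ⁻¹ · y) ≡⟨ cong (x · a ·_) (cancelʳ-inv _ y) ⟩
        x · a · (x ⁻¹ · g) ≡⟨ sym (assoc _ _ _) ⟩
        x · a · x ⁻¹ · g ∎)

    commutator-leftLike : ∀ {s a b u} → s ∈ S → (∀ g → F s g ≡ a · g · b) → u ∈ S →
      Σ (Fin n) λ s′ → s′ ∈ S × (∀ g → F s′ g ≡ u · a · u ⁻¹ · a ⁻¹ · g)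
    commutator-leftLike {s} {a} {b} {u} sS Fs uS with F-conjugate uS
    ... | (p , pS , conjugate) = p · s · p ⁻¹ · s ⁻¹ , ·-closed (conj-closed p sS) (⁻¹-closed sS) , λ g →
      begin
        F (p · s · p ⁻¹ · s ⁻¹) g ≡⟨ F-· (p · s · p ⁻¹) (s ⁻¹) g ⟩
        F (p · s · p ⁻¹) (F (s ⁻¹) g) ≡⟨ sym (conjugate s _) ⟩
        u · F s (u ⁻¹ · F (s ⁻¹) g) ≡⟨ cong (λ w → u · F s (u ⁻¹ · w)) (F-inverse Fs g) ⟩
        u · F s (u ⁻¹ · (a ⁻¹ · g · b ⁻¹)) ≡⟨ cong (u ·_) (Fs _) ⟩
        u · (a · (u ⁻¹ · (a ⁻¹ · g · b ⁻¹)) · b) ≡⟨ cong (u ·_) (assoc _ _ _) ⟩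
        u · (a · (u ⁻¹ · (a ⁻¹ · g · b ⁻¹) · b)) ≡⟨ cong (λ w → u · (a · w)) (assoc _ _ _) ⟩
        u · (a · (u ⁻¹ · (a ⁻¹ · g · b ⁻¹ · b))) ≡⟨ cong (λ w → u · (a · (u ⁻¹ · w))) (cancelʳ-inv _ b) ⟩
        u · (a · (u ⁻¹ · (a ⁻¹ · g))) ≡⟨ sym (assoc _ _ _) ⟩
        u · a · (u ⁻¹ · (a ⁻¹ · g)) ≡⟨ sym (assoc _ _ _) ⟩
        u · a · u ⁻¹ · (a ⁻¹ · g) ≡⟨ sym (assoc _ _ _) ⟩
        u · a · u ⁻¹ · a ⁻¹ · g ∎

    -- if only e is left-like, the left parts of all F s commute with S, so vanish
    swaps-if-trivial : Trivial G K.subset → SwapsSides π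
    swaps-if-trivial triv sS with F-two-sided sS
    ... | (a , b , aS , bS , Fs) =
      b , bS , λ g → trans (Fs g) (cong (_· b) (trans (cong (_· g) a≡e) (identityˡ g)))
      where
      a-central : Centralises S a
      a-central {u} uS with commutator-leftLike sS Fs uS
      ... | (s′ , s′S , Fs′) = ∙-cancelʳ (u ⁻¹) _ _ (trans (inv-cancelʳ a u) (sym uau⁻¹≡a))
        where
        [u,a]∈S : (u · a · u ⁻¹ · a ⁻¹) ∈ S
        [u,a]∈S = ·-closed (conj-closed u aS) (⁻¹-closed aS)
        s′≡e : s′ ≡ e
        s′≡e = triv (K.∈-intro (s′S , _ , [u,a]∈S , Fs′))
        [u,a]≡e : u · a · u ⁻¹ · a ⁻¹ ≡ e
        [u,a]≡e = trans (sym (identityʳ _)) (trans (sym (Fs′ e)) (trans (cong (λ w → F w e) s′≡e) (F-e e)))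
        uau⁻¹≡a : u · a · u ⁻¹ ≡ a
        uau⁻¹≡a = ∙-cancelʳ (a ⁻¹) _ _ (trans [u,a]≡e (sym (inverseʳ a)))
      a≡e : a ≡ e
      a≡e = centre-trivial aS a-central

    -- the left-like elements form a subgroup of the simple group S normalised
    -- by S, hence trivial or all of S
    dichotomy : PreservesSides π ⊎ SwapsSides π
    dichotomy with S-simple K.subset leftLike-subgroup (λ m → proj₁ (K.∈-elim m)) leftLike-normalised
    ... | inj₁ triv = inj₂ (swaps-if-trivial triv)
    ... | inj₂ K≡S = inj₁ λ {s} sS → proj₂ (K.∈-elim (subst (s ∈_) (sym K≡S) sS))

  -- π cannot preserve sides while π⁻¹ swaps them: x₀ would be central
  not-preserves-and-swaps : ∀ {π} → PreservesSides π → SwapsSides (flip π) → ⊥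
  not-preserves-and-swaps {π} pπ sπ⁻ with pπ x₀∈S
  ... | (a , aS , Fx₀) with sπ⁻ aS
  ...   | (b , _ , F⁻a) = x₀≢e (centre-trivial x₀∈S x₀-central)
    where
    open Apply π
    x₀-right : ∀ g → x₀ · g ≡ g · b
    x₀-right g = begin
      x₀ · g ≡⟨ sym (f⁻-f _) ⟩
      f⁻ (f (x₀ · g)) ≡⟨ cong (λ w → f⁻ (f (x₀ · w))) (sym (f⁻-f g)) ⟩
      f⁻ (f (x₀ · f⁻ (f g))) ≡⟨ cong f⁻ (Fx₀ (f g)) ⟩
      f⁻ (a · f g) ≡⟨ F⁻a g ⟩
      g · b ∎
    x₀≡b : x₀ ≡ b
    x₀≡b = trans (sym (identityʳ x₀)) (trans (x₀-right e) (identityˡ b))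
    x₀-central : Centralises S x₀
    x₀-central {t} _ = trans (x₀-right t) (cong (t ·_) (sym x₀≡b))

  swaps⇒inversion-preserves : ∀ {π} → SwapsSides π → PreservesSides (π ∘ₚ inversion)
  swaps⇒inversion-preserves {π} sπ {s} sS with sπ sS
  ... | (b , bS , Fs) = b ⁻¹ , ⁻¹-closed bS , λ g → begin
      (π ⟨$⟩ʳ (s · (π ⟨$⟩ˡ (g ⁻¹)))) ⁻¹ ≡⟨ cong _⁻¹ (Fs (g ⁻¹)) ⟩
      (g ⁻¹ · b) ⁻¹ ≡⟨ ⁻¹-anti-homo-∙ (g ⁻¹) b ⟩
      b ⁻¹ · g ⁻¹ ⁻¹ ≡⟨ cong (b ⁻¹ ·_) (⁻¹-involutive g) ⟩
      b ⁻¹ · g ∎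

  -- With c = π(1) and ψ = c⁻¹ π: π carries u_left to the left
  -- translation by A(u) = π(u) c⁻¹ and, as Z(S) = 1, t_right to the right
  -- translation by ψ(t); both A and ψ map S onto S, and C_G(S) = 1 then
  -- forces ψ to be a homomorphism.
  module Affinity (π : Permutation′ n) (mπ : MapsStar π)
                  (pπ : PreservesSides π) (pπ⁻ : PreservesSides (flip π)) where
    open Apply π

    c : Fin n
    c = f e

    A : Fin n → Fin n
    A u = f u · c ⁻¹

    left-translate : ∀ {u} → u ∈ S → ∀ h → f (u · h) ≡ A u · f h
    left-translate {u} uS h with pπ uS
    ... | (a , _ , Fu) = trans (f-u h) (cong (_· f h) a≡Au)
      where
      f-u : ∀ h → f (u · h) ≡ a · f h
      f-u h = trans (cong (λ w → f (u · w)) (sym (f⁻-f h))) (Fu (f h))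
      a≡Au : a ≡ A u
      a≡Au = solveʳ (trans (sym (f-u e)) (cong f (identityʳ u)))

    A-onto : ∀ {u} → u ∈ S → Σ (Fin n) λ s → s ∈ S × A s ≡ u
    A-onto {u} uS with pπ⁻ uS
    ... | (γ , γS , F⁻u) = γ , γS , sym (∙-cancelʳ c _ _ uc≡Aγc)
      where
      uc≡Aγc : u · c ≡ A γ · c
      uc≡Aγc = trans (sym (f-f⁻ _)) (trans (cong f (F⁻u e)) (left-translate γS e))

    -- π t_right π⁻¹ is a translation g ↦ x g y whose left part x commutes with
    -- every A(s), hence with S, so x = 1 and y = ψ(t)
    right-translate : ∀ {t} → t ∈ S → ∀ h → f (h · t) ≡ f h · linear t
    right-translate {t} tS h with mπ e∈S tS
    ... | (x , y , xS , _ , eq) = trans (f-right h) (cong (f h ·_) y≡ψt)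
      where
      f-two-sided : ∀ k → f (k · t) ≡ x · f k · y
      f-two-sided k =
        trans (cong (λ w → f (w · t)) (trans (sym (identityˡ k)) (cong (e ·_) (sym (f⁻-f k)))))
              (eq (f k))
      x-commutes-A : ∀ {s} → s ∈ S → A s · x ≡ x · A s
      x-commutes-A {s} sS = ∙-cancelʳ (c · y) _ _ (begin
        A s · x · (c · y) ≡⟨ assoc _ _ _ ⟩
        A s · (x · (c · y)) ≡⟨ cong (A s ·_) (sym (assoc _ _ _)) ⟩
        A s · (x · c · y) ≡⟨ cong (A s ·_) (sym (f-two-sided e)) ⟩
        A s · f (e · t) ≡⟨ sym (left-translate sS _) ⟩
        f (s · (e · t)) ≡⟨ cong f (sym (assoc _ _ _)) ⟩
        f (s · e · t) ≡⟨ f-two-sided (s · e) ⟩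
        x · f (s · e) · y ≡⟨ cong (λ w → x · w · y) (left-translate sS e) ⟩
        x · (A s · c) · y ≡⟨ cong (_· y) (sym (assoc _ _ _)) ⟩
        x · A s · c · y ≡⟨ assoc _ _ _ ⟩
        x · A s · (c · y) ∎)
      x-central : Centralises S x
      x-central uS with A-onto uS
      ... | (s , sS , As≡u) = subst (λ w → x · w ≡ w · x) As≡u (sym (x-commutes-A sS))
      f-right : ∀ k → f (k · t) ≡ f k · y
      f-right k = trans (f-two-sided k)
        (cong (_· y) (trans (cong (_· f k) (centre-trivial xS x-central)) (identityˡ _)))
      y≡ψt : y ≡ linear t
      y≡ψt = solveˡ (sym (trans (cong f (sym (identityˡ t))) (f-right e)))

    -- ψ maps S onto S: A(s) = c u c⁻¹ means ψ(s) = u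
    linear-onto : ∀ {u} → u ∈ S → Σ (Fin n) λ s → s ∈ S × linear s ≡ u
    linear-onto {u} uS = let (s , sS , As≡cuc⁻¹) = A-onto (conj-closed c uS) in
      s , sS , (begin
        c ⁻¹ · f s ≡⟨ cong (c ⁻¹ ·_) (sym (cancelʳ-inv (f s) c)) ⟩
        c ⁻¹ · (A s · c) ≡⟨ cong (λ w → c ⁻¹ · (w · c)) As≡cuc⁻¹ ⟩
        c ⁻¹ · (c · u · c ⁻¹ · c) ≡⟨ cong (c ⁻¹ ·_) (cancelʳ-inv _ c) ⟩
        c ⁻¹ · (c · u) ≡⟨ inv-cancelˡ c u ⟩
        u ∎)

    intertwine : ∀ g {s} → s ∈ S → linear g · linear s ≡ linear (g · s · g ⁻¹) · linear g
    intertwine g {s} sS = begin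
      c ⁻¹ · f g · linear s ≡⟨ assoc _ _ _ ⟩
      c ⁻¹ · (f g · linear s) ≡⟨ cong (c ⁻¹ ·_) (sym (right-translate sS g)) ⟩
      c ⁻¹ · f (g · s) ≡⟨ cong (λ w → c ⁻¹ · f w) (sym (cancelʳ-inv (g · s) g)) ⟩
      c ⁻¹ · f (v · g) ≡⟨ cong (c ⁻¹ ·_) (left-translate (conj-closed g sS) g) ⟩
      c ⁻¹ · (f v · c ⁻¹ · f g) ≡⟨ cong (λ w → c ⁻¹ · (w · c ⁻¹ · f g)) (sym (cancelˡ-inv c (f v))) ⟩
      c ⁻¹ · (c · linear v · c ⁻¹ · f g) ≡⟨ cong (c ⁻¹ ·_) (assoc _ _ _) ⟩
      c ⁻¹ · (c · linear v · (c ⁻¹ · f g)) ≡⟨ cong (c ⁻¹ ·_) (assoc _ _ _) ⟩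
      c ⁻¹ · (c · (linear v · (c ⁻¹ · f g))) ≡⟨ inv-cancelˡ c _ ⟩
      linear v · (c ⁻¹ · f g) ∎
      where
      v = g · s · g ⁻¹

    -- ψ(g h) and ψ(g) ψ(h) intertwine ψ(s) alike, so they differ by an
    -- element of C_G(S) = 1
    linear-hom : ∀ g h → linear (g · h) ≡ linear g · linear h
    linear-hom g h = begin
      w ≡⟨ sym (cancelˡ-inv z w) ⟩
      z · (z ⁻¹ · w) ≡⟨ cong (z ·_) (centraliser-trivial z⁻¹w-central) ⟩
      z · e ≡⟨ identityʳ z ⟩
      z ∎
      where
      w = linear (g · h)
      z = linear g · linear h
      z-intertwines : ∀ {s} → s ∈ S → z · linear s ≡ linear (g · h · s · (g · h) ⁻¹) · z
      z-intertwines {s} sS = begin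
        linear g · linear h · linear s ≡⟨ assoc _ _ _ ⟩
        linear g · (linear h · linear s) ≡⟨ cong (linear g ·_) (intertwine h sS) ⟩
        linear g · (linear (h · s · h ⁻¹) · linear h) ≡⟨ sym (assoc _ _ _) ⟩
        linear g · linear (h · s · h ⁻¹) · linear h
          ≡⟨ cong (_· linear h) (intertwine g (conj-closed h sS)) ⟩
        linear (g · (h · s · h ⁻¹) · g ⁻¹) · linear g · linear h
          ≡⟨ cong (λ k → linear k · linear g · linear h) (conj-conj g h s) ⟩
        linear (g · h · s · (g · h) ⁻¹) · linear g · linear h ≡⟨ assoc _ _ _ ⟩
        linear (g · h · s · (g · h) ⁻¹) · z ∎
      z⁻¹w-central : Centralises S (z ⁻¹ · w)
      z⁻¹w-central tS = let (s , sS , ψs≡t) = linear-onto tS in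
        subst (λ t → z ⁻¹ · w · t ≡ t · (z ⁻¹ · w)) ψs≡t
              (same-conjugate (z-intertwines sS) (intertwine (g · h) sS))

    affine : Affine π
    affine h x = begin
      f (h · x) ≡⟨ sym (cancelˡ-inv c _) ⟩
      c · linear (h · x) ≡⟨ cong (c ·_) (linear-hom h x) ⟩
      c · (linear h · linear x) ≡⟨ sym (assoc _ _ _) ⟩
      c · linear h · linear x ≡⟨ cong (_· linear x) (cancelˡ-inv c (f h)) ⟩
      f h · linear x ∎

module Inclusions (G : FinGroup) (S : Subset (FinGroup.n G)) (AS : IsAlmostSimpleWithSocle G S) where
  open GroupAlgebra G
  open Holomorph G
  open TwoSidedTranslations G S
  open AlmostSimple G S AS
  open Sides G S AS

  maps-inversion-S : MapsStar inversion
  maps-inversion-S = maps-inversion ⁻¹-closed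

  maps-hol : ∀ {π} → Hol G π → MapsStar π
  maps-hol {π} h = maps-affine {π} S-normal (hol⇒affine {π} h) (linear-preserves-S {π} (hol⇒affine {π} h))

  D2⇒maps : ∀ {π} → D2 G π → MapsStar π × MapsStar (flip π)
  D2⇒maps (hol {π} h) = maps-hol {π} h , maps-hol {flip π} (hol-flip {π} h)
  D2⇒maps (sig {π} π≗⁻¹) =
    maps-≈ {inversion} {π} σ≈π maps-inversion-S
    , maps-≈ {flip inversion} {flip π} (flip-cong {π = inversion} {π} σ≈π) maps-inversion-S
    where
    σ≈π : inversion Perm.≈ π
    σ≈π g = sym (π≗⁻¹ g)
  D2⇒maps one = maps-id , maps-id
  D2⇒maps (comp {p} {q} dp dq) =
    let (mp , mp⁻) = D2⇒maps dp ; (mq , mq⁻) = D2⇒maps dq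
    in maps-∘ {p} {q} mp mq , maps-∘ {flip q} {flip p} mq⁻ mp⁻
  D2⇒maps (inv d) = let (m , m⁻) = D2⇒maps d in m⁻ , m
  D2⇒maps (ext {p} {q} p≈q d) =
    let (m , m⁻) = D2⇒maps d
    in maps-≈ {p} {q} p≈q m , maps-≈ {flip p} {flip q} (flip-cong {π = p} {q} p≈q) m⁻

  -- a side-preserving π ∈ N lies in Hol(G): π⁻¹ cannot swap sides, so it
  -- preserves them too and π is affine
  preserving⇒hol : ∀ {π} → MapsStar π → MapsStar (flip π) → PreservesSides π → Hol G π
  preserving⇒hol {π} mπ mπ⁻ pπ with Dichotomy.dichotomy (flip π) mπ⁻ mπ
  ... | inj₁ pπ⁻ = affine⇒hol {π} (Affinity.affine π mπ pπ pπ⁻)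
  ... | inj₂ sπ⁻ = ⊥-elim (not-preserves-and-swaps {π} pπ sπ⁻)

  -- a side-swapping π ∈ N is (π σ) σ with π σ ∈ Hol(G)
  maps⇒D2 : ∀ {π} → MapsStar π → MapsStar (flip π) → D2 G π
  maps⇒D2 {π} mπ mπ⁻ with Dichotomy.dichotomy π mπ mπ⁻
  ... | inj₁ pπ = hol {p = π} (preserving⇒hol {π} mπ mπ⁻ pπ)
  ... | inj₂ sπ = ext {p = τ ∘ₚ inversion} {π} τσ≈π
                   (comp {p = τ} {inversion} (hol {p = τ} τ-hol) (sig {p = inversion} λ _ → refl))
    where
    τ : Permutation′ n
    τ = π ∘ₚ inversion
    τ-hol : Hol G τ
    τ-hol = preserving⇒hol {τ} (maps-∘ {π} {inversion} mπ maps-inversion-S)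
                               (maps-∘ {inversion} {flip π} maps-inversion-S mπ⁻)
                               (swaps⇒inversion-preserves {π} sπ)
    τσ≈π : τ ∘ₚ inversion Perm.≈ π
    τσ≈π g = ⁻¹-involutive (π ⟨$⟩ʳ g)

  normaliser⊆D2 : ∀ {π} → Normalizer G (Star G S) π → D2 G π
  normaliser⊆D2 {π} N = let (m , m⁻) = normaliser⇒maps {π} N in maps⇒D2 {π} m m⁻

  D2⊆normaliser : ∀ {π} → D2 G π → Normalizer G (Star G S) π
  D2⊆normaliser {π} d = let (m , m⁻) = D2⇒maps d in maps⇒normaliser {π} m m⁻

theorem5p1 : (G : FinGroup) (S : Subset (FinGroup.n G)) → IsAlmostSimpleWithSocle G S
    → (π : Permutation′ (FinGroup.n G)) → (Normalizer G (Star G S) π ⇔ D2 G π)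
theorem5p1 G S AS π = mk⇔ normaliser⊆D2 D2⊆normaliser
  where open Inclusions G S AS
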